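{- There exists an absolute constant $c>0$ such that for every $\Delta$ there is a bipartite $\Delta$-bounded graph sequence $\mathcal{F}=\{F_1,F_2,\ldots\}$ and there is a $2$-edge-coloring of a complete graph $K_n$ (for some $n$) such that any covering of the vertices of $K_n$ by vertex-disjoint monochromatic copies of graphs from $\mathcal{F}$ uses at least $2^{c\Delta}$ such copies.
   Context: A sequence $\mathcal{F}=\{F_1,F_2,\ldots\}$ of graphs is $\Delta$-bounded if for every $n$, $F_n$ is a graph on exactly $n$ vertices with maximum degree at most $\Delta$; it is bipartite if every $F_n$ is bipartite. A monochromatic copy of a graph $F$ in an edge-colored complete graph is a subgraph isomorphic to $F$ all of whose edges have the same color. -}

module Defs where

open import Data.Nat using (ℕ; zero; suc; _+_; _≤_; _^_)
open import Data.Bool using (Bool; true; false)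
open import Data.Fin using (Fin)
open import Data.List using (List; filter; length; allFin)
open import Data.Product using (Σ; ∃; ∃-syntax; _×_; _,_)
open import Relation.Binary.PropositionalEquality using (_≡_; _≢_)
open import Relation.Nullary using (¬_)
open import Relation.Nullary.Decidable using (does)
open import Data.Bool.Properties using () renaming (_≟_ to _≟B_)
open import Function.Definitions using (Injective)

record Graph (n : ℕ) : Set where
  field
    adj   : Fin n → Fin n → Bool
    sym   : ∀ u v → adj u v ≡ adj v u
    irrefl : ∀ v → adj v v ≡ false
open Graph public

degree : ∀ {n} → Graph n → Fin n → ℕ
degree G v = length (filter (λ u → adj G v u ≟B true) (allFin _))

MaxDegreeAtMost : ∀ {n} → ℕ → Graph n → Set
MaxDegreeAtMost Δ G = ∀ v → degree G v ≤ Δ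

Bipartite : ∀ {n} → Graph n → Set
Bipartite {n} G = Σ (Fin n → Bool) λ side → ∀ u v → adj G u v ≡ true → side u ≢ side v

-- A graph sequence F = {F₁, F₂, …}: (seq k) is the graph F_{k+1},
-- a graph on exactly k+1 vertices.
GraphSeq : Set
GraphSeq = (k : ℕ) → Graph (suc k)

ΔBounded : ℕ → GraphSeq → Set
ΔBounded Δ F = ∀ k → MaxDegreeAtMost Δ (F k)

BipartiteSeq : GraphSeq → Set
BipartiteSeq F = ∀ k → Bipartite (F k)

-- A 2-edge-colouring of the complete graph K_n (symmetric; diagonal unused).
record Colouring (n : ℕ) : Set where
  field
    col  : Fin n → Fin n → Bool
    csym : ∀ u v → col u v ≡ col v u
open Colouring public

record MonoCopy (F : GraphSeq) {n : ℕ} (c : Colouring n) : Set where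
  field
    k      : ℕ
    colour : Bool
    emb    : Fin (suc k) → Fin n
    inj    : Injective _≡_ _≡_ emb
    mono   : ∀ i j → adj (F k) i j ≡ true → col c (emb i) (emb j) ≡ colour
open MonoCopy public

record Cover (F : GraphSeq) {n : ℕ} (c : Colouring n) (t : ℕ) : Set where
  field
    copy     : Fin t → MonoCopy F c
    disjoint : ∀ a b x y → emb (copy a) x ≡ emb (copy b) y → a ≡ b
    covers   : ∀ v → ∃[ a ] ∃[ x ] (emb (copy a) x ≡ v)
open Cover public

module Submission where

-- The sequence is H_Δ: its member on k+1 vertices consists of two disjoint
-- copies of K_{Δ,Δ} on the first 4Δ vertices (the core) and isolated vertices.
-- If a colouring has no monochromatic core, every monochromatic copy has fewer
-- than 4Δ vertices, so a cover of K_n needs at least n/(4Δ) copies.  For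
-- 1 ≤ Δ ≤ 64 the star colouring of K_{4Δ} has no monochromatic core, forcing two
-- copies.  For Δ > 64 Erdős's colouring of K_n, n = 2^(8b) with 16b + 1 < Δ ≤ 64b,
-- has no monochromatic K_{Δ,Δ}, forcing 2^b copies.  That colouring comes from a
-- constructive union bound: events given by partial assignments of the edge
-- colours with total weight below 2^(number of edges) are avoided by fixing the
-- edges one at a time.

open import Defs hiding (sym)
open import Data.Nat using (ℕ; zero; suc; pred; _+_; _*_; _^_; _≤_; _<_; z≤n; s≤s; s≤s⁻¹; s<s⁻¹; _/_; _%_)
open import Data.Nat.Properties
open import Data.Nat.DivMod using (m≡m%n+[m/n]*n; m%n<n; m≥n⇒m/n>0)
open import Data.Nat.Tactic.RingSolver using (solve-∀)
open import Data.Bool using (Bool; true; false; not; _∧_; if_then_else_)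
open import Data.Bool.Properties using (∧-comm) renaming (_≟_ to _≟B_)
open import Data.Maybe using (Maybe; just; nothing)
open import Data.Fin using (Fin; zero; suc; toℕ; fromℕ<; inject≤; combine; remQuot; quotient; remainder; finToFun; funToFin; punchIn; punchOut)
open import Data.Fin.Patterns using (0F; 1F; 2F; 3F)
open import Data.Fin.Properties using (toℕ<n; toℕ-fromℕ<; fromℕ<-toℕ; toℕ-injective; toℕ-inject≤; inject≤-injective; toℕ-combine; combine-injective; combine-remQuot; remQuot-combine; finToFun-funToFin; injective⇒≤; punchOut-injective; punchIn-punchOut; punchInᵢ≢i; punchIn-injective; any?; all?) renaming (_≟_ to _≟F_)
open import Data.Vec.Functional using (Vector; tail) renaming (_∷_ to _∷ᵥ_)
open import Data.List using (List; []; _∷_; map; filter; length; tabulate; allFin)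
open import Data.List.Properties using (length-tabulate)
open import Data.List.Membership.Propositional using (_∈_)
open import Data.List.Membership.Propositional.Properties using (∈-allFin; ∈-filter⁺; ∈-map⁺)
open import Data.List.Relation.Unary.All as All using (All; []; _∷_)
open import Data.Product using (Σ; _×_; _,_; proj₁; proj₂; ∃-syntax; uncurry)
open import Data.Sum using (_⊎_; inj₁; inj₂)
open import Data.Empty using (⊥; ⊥-elim)
open import Relation.Nullary using (¬_; yes; no; does)
open import Relation.Nullary.Decidable using (_→-dec_; map′; dec-true)
open import Relation.Unary using (Decidable)
open import Relation.Binary.PropositionalEquality
open import Function using (_∘_)
open import Function.Definitions using (Injective)

-- It stands for the event
-- that a total assignment σ extends it; freeCount counts its undefined
-- positions, so exactly 2^(freeCount E) assignments extend E.
Partial : ℕ → Set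
Partial = Vector (Maybe Bool)

Extends : ∀ {N} → (Fin N → Bool) → Partial N → Set
Extends σ E = ∀ p b → E p ≡ just b → σ p ≡ b

undefinedAt : Maybe Bool → ℕ
undefinedAt nothing  = 1
undefinedAt (just _) = 0

freeCount : ∀ {N} → Partial N → ℕ
freeCount {zero}  E = 0
freeCount {suc N} E = undefinedAt (E zero) + freeCount (tail E)

-- The number of pairs (E, σ) with E ∈ Es and σ extending E; it bounds the
-- number of assignments extending some event.
weight : ∀ {N} → List (Partial N) → ℕ
weight []       = 0
weight (E ∷ Es) = 2 ^ freeCount E + weight Es

-- Conditioning on the first position having value b: the events that allow b
-- survive, restricted to the remaining positions.
allows : Bool → Maybe Bool → Bool
allows _     nothing  = true
allows true  (just c) = c
allows false (just c) = not c

restrict : ∀ {N} → Bool → List (Partial (suc N)) → List (Partial N)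
restrict b []       = []
restrict b (E ∷ Es) = if allows b (E zero) then tail E ∷ restrict b Es else restrict b Es

weight-split : ∀ {N} (Es : List (Partial (suc N))) →
               weight (restrict true Es) + weight (restrict false Es) ≡ weight Es
weight-split []       = refl
weight-split (E ∷ Es) with E zero | weight-split Es
... | nothing    | ih = trans (both (2 ^ freeCount (tail E)) _ _) (cong (2 ^ suc (freeCount (tail E)) +_) ih)
  where
  both : ∀ a x y → (a + x) + (a + y) ≡ 2 * a + (x + y)
  both = solve-∀
... | just true  | ih = trans (+-assoc (2 ^ freeCount (tail E)) _ _) (cong (2 ^ freeCount (tail E) +_) ih)
... | just false | ih = trans (right (2 ^ freeCount (tail E)) (weight (restrict true Es)) _) (cong (2 ^ freeCount (tail E) +_) ih)
  where
  right : ∀ a x y → x + (a + y) ≡ a + (x + y)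
  right = solve-∀

extends-allows : ∀ {N} b (σ : Fin N → Bool) (E : Partial (suc N)) →
                 Extends (b ∷ᵥ σ) E → allows b (E zero) ≡ true
extends-allows b σ E ext with E zero in eq
extends-allows b     σ E ext | nothing = refl
extends-allows true  σ E ext | just c  = sym (ext zero c eq)
extends-allows false σ E ext | just c  = cong not (sym (ext zero c eq))

avoids-restrict : ∀ {N} b (σ : Fin N → Bool) (Es : List (Partial (suc N))) →
                  All (λ E → ¬ Extends σ E) (restrict b Es) → All (λ E → ¬ Extends (b ∷ᵥ σ) E) Es
avoids-restrict b σ []       _ = []
avoids-restrict b σ (E ∷ Es) av with allows b (E zero) in eq
avoids-restrict b σ (E ∷ Es) (¬ext ∷ av) | true =
  (λ ext → ¬ext (λ p → ext (suc p))) ∷ avoids-restrict b σ Es av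
avoids-restrict b σ (E ∷ Es) av | false =
  (λ ext → false≢true (trans (sym eq) (extends-allows b σ E ext))) ∷ avoids-restrict b σ Es av
  where
  false≢true : false ≡ true → ⊥
  false≢true ()

one-below-half : ∀ x y a → x + y < a + a → x < a ⊎ y < a
one-below-half x y a x+y<2a with x <? a
... | yes x<a = inj₁ x<a
... | no  x≮a = inj₂ (+-cancelˡ-< a y a (≤-<-trans (+-monoˡ-≤ y (≮⇒≥ x≮a)) x+y<2a))

-- The constructive union bound (method of conditional expectations): if the
-- weight is below 2^N, some σ extends none of the events.  Fix the first
-- position to a value whose conditioned weight is below 2^(N-1) and recurse.
avoid : ∀ N (Es : List (Partial N)) → weight Es < 2 ^ N →
        Σ (Fin N → Bool) λ σ → All (λ E → ¬ Extends σ E) Es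
avoid zero    []       _         = (λ ()) , []
avoid zero    (E ∷ Es) (s≤s ())
avoid (suc N) Es       w<2^[1+N] with one-below-half _ _ (2 ^ N) split
  where
  split : weight (restrict true Es) + weight (restrict false Es) < 2 ^ N + 2 ^ N
  split = subst₂ _<_ (sym (weight-split Es)) (cong (2 ^ N +_) (+-identityʳ (2 ^ N))) w<2^[1+N]
... | inj₁ wT<2^N = let σ , av = avoid N (restrict true Es) wT<2^N in
                    true ∷ᵥ σ , avoids-restrict true σ Es av
... | inj₂ wF<2^N = let σ , av = avoid N (restrict false Es) wF<2^N in
                    false ∷ᵥ σ , avoids-restrict false σ Es av

undefinedAt≤1 : ∀ v → undefinedAt v ≤ 1
undefinedAt≤1 nothing  = s≤s z≤n
undefinedAt≤1 (just _) = z≤n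

-- An event defined on the image of an injection from Fin m has at most N - m
-- free positions.  Induction on N: drop position 0, removing it from the
-- image first if it lies there.
mutual
  free-image : ∀ {N m} (E : Partial N) (g : Fin m → Fin N) → Injective _≡_ _≡_ g →
               (∀ x → E (g x) ≢ nothing) → freeCount E + m ≤ N
  free-image {zero}  {zero}  E g inj def = z≤n
  free-image {zero}  {suc m} E g inj def with g zero
  ... | ()
  free-image {suc N} {m}     E g inj def with any? (λ x → zero ≟F g x)
  ... | no zero∉g =
    ≤-trans (+-monoˡ-≤ m (+-monoˡ-≤ (freeCount (tail E)) (undefinedAt≤1 (E zero))))
            (s≤s (free-tail E g inj (λ x z≡gx → zero∉g (x , z≡gx)) def))
  free-image {suc N} {suc m} E g inj def | yes (x₀ , z≡gx₀) =
    subst (_≤ suc N) (sym (trans (cong (_+ suc m) head-defined) (+-suc (freeCount (tail E)) m)))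
          (s≤s (free-tail E (g ∘ punchIn x₀) (punchIn-injective x₀ _ _ ∘ inj) avoids (def ∘ punchIn x₀)))
    where
    head-defined : undefinedAt (E zero) + freeCount (tail E) ≡ freeCount (tail E)
    head-defined with E zero in eq
    ... | just _  = refl
    ... | nothing = ⊥-elim (def x₀ (trans (cong E (sym z≡gx₀)) eq))
    avoids : ∀ y → zero ≢ g (punchIn x₀ y)
    avoids y z≡g = punchInᵢ≢i x₀ y (inj (trans (sym z≡g) z≡gx₀))

  free-tail : ∀ {N m} (E : Partial (suc N)) (g : Fin m → Fin (suc N)) → Injective _≡_ _≡_ g →
              (∀ x → zero ≢ g x) → (∀ x → E (g x) ≢ nothing) → freeCount (tail E) + m ≤ N
  free-tail E g inj avoids def =
    free-image (tail E) (λ x → punchOut (avoids x))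
               (λ {x} {y} eq → inj (punchOut-injective (avoids x) (avoids y) eq))
               (λ x → def x ∘ trans (cong E (sym (punchIn-punchOut (avoids x)))))

weight-bound : ∀ {A : Set} {P : A → Set} (P? : Decidable P) {N} (event : A → Partial N) r →
               (∀ a → P a → freeCount (event a) + r ≤ N) →
               ∀ xs → weight (map event (filter P? xs)) * 2 ^ r ≤ length xs * 2 ^ N
weight-bound P? event r bound []       = z≤n
weight-bound P? {N} event r bound (a ∷ xs) with P? a
... | no  _  = ≤-trans (weight-bound P? event r bound xs) (m≤n+m _ (2 ^ N))
... | yes Pa = begin
  (2 ^ f + w) * 2 ^ r         ≡⟨ *-distribʳ-+ (2 ^ r) (2 ^ f) w ⟩
  2 ^ f * 2 ^ r + w * 2 ^ r   ≡⟨ cong (_+ w * 2 ^ r) (^-distribˡ-+-* 2 f r) ⟨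
  2 ^ (f + r) + w * 2 ^ r     ≤⟨ +-mono-≤ (^-monoʳ-≤ 2 (bound a Pa)) (weight-bound P? event r bound xs) ⟩
  2 ^ N + length xs * 2 ^ N   ∎
  where
  open ≤-Reasoning
  f w : ℕ
  f = freeCount (event a)
  w = weight (map event (filter P? xs))

IsBiclique : ∀ {n s} → (Fin s → Fin n) → (Fin s → Fin n) → Set
IsBiclique F G = Injective _≡_ _≡_ F × Injective _≡_ _≡_ G × (∀ i j → F i ≢ G j)

BicliqueFree : ∀ {n} → ℕ → Colouring n → Set
BicliqueFree {n} s c = ∀ (F G : Fin s → Fin n) (χ : Bool) → IsBiclique F G → ¬ (∀ i j → col c (F i) (G j) ≡ χ)

module _ {n : ℕ} where

  -- The edge {u, v} of K_n, coded as the ordered pair (min, max) in Fin (n * n).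
  edge : Fin n → Fin n → Fin (n * n)
  edge u v with toℕ u ≤? toℕ v
  ... | yes _ = combine u v
  ... | no  _ = combine v u

  edge-sym : ∀ u v → edge u v ≡ edge v u
  edge-sym u v with toℕ u ≤? toℕ v | toℕ v ≤? toℕ u
  ... | yes u≤v | yes v≤u rewrite toℕ-injective (≤-antisym u≤v v≤u) = refl
  ... | yes _   | no  _   = refl
  ... | no  _   | yes _   = refl
  ... | no  u≰v | no  v≰u = ⊥-elim (u≰v (≰⇒≥ v≰u))

  edge-ordered : ∀ u v → edge u v ≡ combine u v ⊎ edge u v ≡ combine v u
  edge-ordered u v with toℕ u ≤? toℕ v
  ... | yes _ = inj₁ refl
  ... | no  _ = inj₂ refl

  edge-injective : ∀ u v u′ v′ → edge u v ≡ edge u′ v′ → (u ≡ u′ × v ≡ v′) ⊎ (u ≡ v′ × v ≡ u′)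
  edge-injective u v u′ v′ eq with edge-ordered u v | edge-ordered u′ v′
  ... | inj₁ e | inj₁ e′ = inj₁ (combine-injective u v u′ v′ (trans (sym e) (trans eq e′)))
  ... | inj₁ e | inj₂ e′ = inj₂ (combine-injective u v v′ u′ (trans (sym e) (trans eq e′)))
  ... | inj₂ e | inj₁ e′ = let v≡u′ , u≡v′ = combine-injective v u u′ v′ (trans (sym e) (trans eq e′))
                           in inj₂ (u≡v′ , v≡u′)
  ... | inj₂ e | inj₂ e′ = let v≡v′ , u≡u′ = combine-injective v u v′ u′ (trans (sym e) (trans eq e′))
                           in inj₁ (u≡u′ , v≡v′)

  module _ {s : ℕ} (F G : Fin s → Fin n) where

    grid : Fin (s * s) → Fin (n * n)
    grid x = edge (F (quotient s x)) (G (remainder {s} s x))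

    grid-injective : IsBiclique F G → Injective _≡_ _≡_ grid
    grid-injective (F-inj , G-inj , apart) {x} {y} eq
      with edge-injective (F (quotient s x)) (G (remainder {s} s x))
                          (F (quotient s y)) (G (remainder {s} s y)) eq
    ... | inj₂ (Fx≡Gy , _) = ⊥-elim (apart _ _ Fx≡Gy)
    ... | inj₁ (Fx≡Fy , Gx≡Gy) = begin
      x                                   ≡⟨ combine-remQuot {s} s x ⟨
      uncurry combine (remQuot {s} s x)   ≡⟨ cong₂ combine (F-inj Fx≡Fy) (G-inj Gx≡Gy) ⟩
      uncurry combine (remQuot {s} s y)   ≡⟨ combine-remQuot {s} s y ⟩
      y                                   ∎
      where open ≡-Reasoning

    monoEvent : Bool → Partial (n * n)
    monoEvent χ p with any? (λ x → grid x ≟F p)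
    ... | yes _ = just χ
    ... | no  _ = nothing

    monoEvent-defined : ∀ χ x → monoEvent χ (grid x) ≢ nothing
    monoEvent-defined χ x with any? (λ y → grid y ≟F grid x)
    ... | yes _    = λ ()
    ... | no  none = ⊥-elim (none (x , refl))

    monoEvent-free : ∀ χ → Injective _≡_ _≡_ grid → freeCount (monoEvent χ) + s * s ≤ n * n
    monoEvent-free χ distinct = free-image (monoEvent χ) grid distinct (monoEvent-defined χ)

    extends-monoEvent : ∀ σ χ → (∀ i j → σ (edge (F i) (G j)) ≡ χ) → Extends σ (monoEvent χ)
    extends-monoEvent σ χ mono p b eq with any? (λ x → grid x ≟F p)
    extends-monoEvent σ χ mono p b refl | yes (x , refl) = mono _ _
    extends-monoEvent σ χ mono p b ()   | no  _

bit : Fin 2 → Bool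
bit zero    = false
bit (suc _) = true

bitOf : Bool → Fin 2
bitOf false = zero
bitOf true  = suc zero

bit-bitOf : ∀ b → bit (bitOf b) ≡ b
bit-bitOf false = refl
bit-bitOf true  = refl

biclique-≗ : ∀ {n s} {F F′ G G′ : Fin s → Fin n} → (∀ i → F′ i ≡ F i) → (∀ j → G′ j ≡ G j) →
             IsBiclique F G → IsBiclique F′ G′
biclique-≗ {F′ = F′} {G′ = G′} eF eG (F-inj , G-inj , apart) =
  (λ {i} {i′} eq → F-inj (trans (sym (eF i)) (trans eq (eF i′)))) ,
  (λ {j} {j′} eq → G-inj (trans (sym (eG j)) (trans eq (eG j′)))) ,
  (λ i j eq → apart i j (trans (sym (eF i)) (trans eq (eG j))))

edgeColouring : ∀ {n} → (Fin (n * n) → Bool) → Colouring n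
edgeColouring σ = record { col = λ u v → σ (edge u v) ; csym = λ u v → cong σ (edge-sym u v) }

module Erdős (n s : ℕ) where

  -- A candidate monochromatic K_{s,s}: its sides coded in Fin (n ^ s) via
  -- finToFun, and its colour as a bit.
  Candidate : Set
  Candidate = Fin ((n ^ s * n ^ s) * 2)

  leftOf rightOf : Candidate → Fin s → Fin n
  leftOf  x = finToFun (quotient (n ^ s) (quotient 2 x))
  rightOf x = finToFun (remainder {n ^ s} (n ^ s) (quotient 2 x))

  colourOf : Candidate → Bool
  colourOf x = bit (remainder {n ^ s * n ^ s} 2 x)

  candidate : (Fin s → Fin n) → (Fin s → Fin n) → Bool → Candidate
  candidate F G χ = combine (combine (funToFin F) (funToFin G)) (bitOf χ)

  module _ (F G : Fin s → Fin n) (χ : Bool) where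
    private
      x : Candidate
      x = candidate F G χ
      outer : remQuot 2 x ≡ (combine (funToFin F) (funToFin G) , bitOf χ)
      outer = remQuot-combine {n ^ s * n ^ s} (combine (funToFin F) (funToFin G)) (bitOf χ)
      inner : remQuot (n ^ s) (combine (funToFin F) (funToFin G)) ≡ (funToFin F , funToFin G)
      inner = remQuot-combine {n ^ s} (funToFin F) (funToFin G)

    leftOf-candidate : ∀ i → leftOf x i ≡ F i
    leftOf-candidate i = trans (cong (λ y → finToFun (proj₁ (remQuot (n ^ s) (proj₁ y))) i) outer)
                               (trans (cong (λ y → finToFun (proj₁ y) i) inner) (finToFun-funToFin F i))

    rightOf-candidate : ∀ j → rightOf x j ≡ G j
    rightOf-candidate j = trans (cong (λ y → finToFun (proj₂ (remQuot {n ^ s} (n ^ s) (proj₁ y))) j) outer)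
                                (trans (cong (λ y → finToFun (proj₂ y) j) inner) (finToFun-funToFin G j))

    colourOf-candidate : colourOf x ≡ χ
    colourOf-candidate = trans (cong (bit ∘ proj₂) outer) (bit-bitOf χ)

  -- Candidates whose edges are pairwise distinct; exactly these get an event.
  Genuine : Candidate → Set
  Genuine x = Injective _≡_ _≡_ (grid (leftOf x) (rightOf x))

  genuine? : Decidable Genuine
  genuine? x = map′ (λ h {a} {b} → h a b) (λ h a b → h)
                    (all? λ a → all? λ b → (grid (leftOf x) (rightOf x) a ≟F grid (leftOf x) (rightOf x) b) →-dec (a ≟F b))

  eventOf : Candidate → Partial (n * n)
  eventOf x = monoEvent (leftOf x) (rightOf x) (colourOf x)

  events : List (Partial (n * n))
  events = map eventOf (filter genuine? (allFin _))

  -- Each genuine event fixes s² of the n² positions.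
  events-weight : weight events * 2 ^ (s * s) ≤ ((n ^ s * n ^ s) * 2) * 2 ^ (n * n)
  events-weight = subst (λ L → weight events * 2 ^ (s * s) ≤ L * 2 ^ (n * n)) (length-tabulate {n = (n ^ s * n ^ s) * 2} (λ x → x))
    (weight-bound genuine? eventOf (s * s)
      (λ x → monoEvent-free (leftOf x) (rightOf x) (colourOf x)) (allFin _))

  avoiding⇒biclique-free : ∀ σ → All (λ E → ¬ Extends σ E) events → BicliqueFree s (edgeColouring σ)
  avoiding⇒biclique-free σ avoids F G χ isB mono = All.lookup avoids member extends
    where
    x : Candidate
    x = candidate F G χ
    genuine : Genuine x
    genuine = grid-injective (leftOf x) (rightOf x) (biclique-≗ (leftOf-candidate F G χ) (rightOf-candidate F G χ) isB)
    member : eventOf x ∈ events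
    member = ∈-map⁺ eventOf (∈-filter⁺ genuine? (∈-allFin x) genuine)
    extends : Extends σ (eventOf x)
    extends = extends-monoEvent (leftOf x) (rightOf x) σ (colourOf x)
      (λ i j → trans (cong₂ (λ u v → σ (edge u v)) (leftOf-candidate F G χ i) (rightOf-candidate F G χ j))
                     (trans (mono i j) (sym (colourOf-candidate F G χ))))

  biclique-free-colouring : (n ^ s * n ^ s) * 2 < 2 ^ (s * s) → Σ (Colouring n) (BicliqueFree s)
  biclique-free-colouring few = edgeColouring σ , avoiding⇒biclique-free σ avoids
    where
    few-events : weight events < 2 ^ (n * n)
    few-events = *-cancelʳ-< (2 ^ (s * s)) (weight events) (2 ^ (n * n))
      (≤-<-trans events-weight
        (subst (((n ^ s * n ^ s) * 2) * 2 ^ (n * n) <_) (*-comm (2 ^ (s * s)) (2 ^ (n * n)))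
               (*-monoˡ-< (2 ^ (n * n)) {{m^n≢0 2 (n * n)}} few)))
    σ : Fin (n * n) → Bool
    σ = proj₁ (avoid (n * n) events few-events)
    avoids : All (λ E → ¬ Extends σ E) events
    avoids = proj₂ (avoid (n * n) events few-events)

-- The blocks 0,1 and 2,3 of H_d span complete bipartite graphs K_{d,d}.
partner : Fin 4 → Fin 4
partner 0F = 1F
partner 1F = 0F
partner 2F = 3F
partner 3F = 2F

partner-involutive : ∀ a → partner (partner a) ≡ a
partner-involutive 0F = refl
partner-involutive 1F = refl
partner-involutive 2F = refl
partner-involutive 3F = refl

side : Fin 4 → Bool
side 0F = false
side 1F = true
side 2F = false
side 3F = true

side-partner : ∀ a → side a ≢ side (partner a)
side-partner 0F ()
side-partner 1F ()
side-partner 2F ()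
side-partner 3F ()

-- The side of a vertex; vertices outside every block are isolated and may go anywhere.
sideOf : Maybe (Fin 4) → Bool
sideOf (just a) = side a
sideOf nothing  = false

linked : Maybe (Fin 4) → Maybe (Fin 4) → Bool
linked (just a) (just b) = does (partner a ≟F b)
linked _        _        = false

linked-just : ∀ a y → linked (just a) y ≡ true → y ≡ just (partner a)
linked-just a (just b) adj with partner a ≟F b
... | yes pa≡b = cong just (sym pa≡b)
linked-just a nothing ()

linked-partner : ∀ a → linked (just a) (just (partner a)) ≡ true
linked-partner a = dec-true (partner a ≟F partner a) refl

-- Hence adjacency is symmetric (partner is an involution), irreflexive (no block
-- is its own partner) and joins opposite sides.
linked-sym : ∀ x y → linked x y ≡ linked y x
linked-sym (just a) (just b) with partner a ≟F b | partner b ≟F a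
... | yes _    | yes _    = refl
... | no  _    | no  _    = refl
... | yes pa≡b | no  pb≢a = ⊥-elim (pb≢a (trans (cong partner (sym pa≡b)) (partner-involutive a)))
... | no  pa≢b | yes pb≡a = ⊥-elim (pa≢b (trans (cong partner (sym pb≡a)) (partner-involutive b)))
linked-sym (just _) nothing  = refl
linked-sym nothing  (just _) = refl
linked-sym nothing  nothing  = refl

linked-irreflexive : ∀ x → linked x x ≡ false
linked-irreflexive (just a) with partner a ≟F a
... | yes pa≡a = ⊥-elim (side-partner a (cong side (sym pa≡a)))
... | no  _    = refl
linked-irreflexive nothing = refl

linked-sides : ∀ x y → linked x y ≡ true → sideOf x ≢ sideOf y
linked-sides (just a) y adj rewrite linked-just a y adj = side-partner a

-- The core of H_d is Fin (4 * d); its vertex (a, i) is the i-th vertex of block a.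
vertex : ∀ {d} → Fin 4 → Fin d → Fin (4 * d)
vertex = combine

vertex-injective : ∀ {d} a (i : Fin d) b j → vertex a i ≡ vertex b j → a ≡ b × i ≡ j
vertex-injective = combine-injective

-- The block of vertex x of H_d: below 4·d, vertex d·a + i (i < d) lies in
-- block a; all later vertices lie in no block and are isolated.
block : ℕ → ℕ → Maybe (Fin 4)
block d x with x <? 4 * d
... | yes x<4d = just (quotient d (fromℕ< x<4d))
... | no  _    = nothing

block-vertex : ∀ d a (i : Fin d) → block d (toℕ (vertex a i)) ≡ just a
block-vertex d a i with toℕ (vertex a i) <? 4 * d
... | yes lt = cong just (trans (cong (quotient d) (fromℕ<-toℕ (vertex a i) lt))
                                (cong proj₁ (remQuot-combine a i)))
... | no  ≮  = ⊥-elim (≮ (toℕ<n (vertex a i)))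

block-window : ∀ d x a → block d x ≡ just a → d * toℕ a ≤ x × x < d * toℕ a + d
block-window d x a eq with x <? 4 * d
block-window d x a refl | yes x<4d =
  subst (λ z → d * toℕ a ≤ z × z < d * toℕ a + d) position
        (m≤m+n (d * toℕ a) (toℕ i) , +-monoʳ-< (d * toℕ a) (toℕ<n i))
  where
  i : Fin d
  i = remainder {4} d (fromℕ< x<4d)
  position : d * toℕ a + toℕ i ≡ x
  position = begin
    d * toℕ a + toℕ i                   ≡⟨ toℕ-combine a i ⟨
    toℕ (vertex a i)                    ≡⟨ cong toℕ (combine-remQuot {4} d (fromℕ< x<4d)) ⟩
    toℕ (fromℕ< x<4d)                   ≡⟨ toℕ-fromℕ< x<4d ⟩
    x                                   ∎
    where open ≡-Reasoning

neighbour-window : ∀ d x → Σ ℕ λ lo → ∀ y → linked x (block d y) ≡ true → lo ≤ y × y < lo + d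
neighbour-window d nothing  = 0 , λ y ()
neighbour-window d (just a) = d * toℕ (partner a) , λ y adj → block-window d y (partner a) (linked-just a (block d y) adj)

-- At most d of the numbers 0, 1, …, m−1 fall into a window [lo, lo + d);
-- stated for an arbitrary tabulated list so that the induction goes through.
count-window : ∀ {A : Set} m (f : Fin m → A) (R : A → Bool) (Q : ℕ → Bool) → (∀ i → R (f i) ≡ Q (toℕ i)) →
               ∀ lo d → (∀ y → Q y ≡ true → lo ≤ y × y < lo + d) →
               length (filter (λ a → R a ≟B true) (tabulate f)) ≤ d
count-window zero    f R Q RQ lo d window = z≤n
count-window (suc m) f R Q RQ lo d window with R (f zero) in eq
... | true  with window 0 (trans (sym (RQ zero)) eq)
...   | z≤n , s≤s _ =
  s≤s (count-window m (f ∘ suc) R (Q ∘ suc) (RQ ∘ suc) 0 _ (λ y q → z≤n , s≤s⁻¹ (proj₂ (window (suc y) q))))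
count-window (suc m) f R Q RQ lo d window | false =
  count-window m (f ∘ suc) R (Q ∘ suc) (RQ ∘ suc) (pred lo) d (λ y q → shift lo y (window (suc y) q))
  where
  shift : ∀ lo y → lo ≤ suc y × suc y < lo + d → pred lo ≤ y × y < pred lo + d
  shift zero     y (_ , y+1<d)      = z≤n , <-trans (n<1+n y) y+1<d
  shift (suc lo) y (lo≤y+1 , y+1<lo+d) = s≤s⁻¹ lo≤y+1 , s<s⁻¹ y+1<lo+d

-- The sequence H_d: F_{k+1} is H_d restricted to its first k+1 vertices, i.e.
-- two disjoint copies of K_{d,d} (as far as they fit) plus isolated vertices.
H : ℕ → GraphSeq
H d k = record
  { adj    = λ u v → linked (block d (toℕ u)) (block d (toℕ v))
  ; sym    = λ u v → linked-sym (block d (toℕ u)) (block d (toℕ v))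
  ; irrefl = λ v → linked-irreflexive (block d (toℕ v))
  }

H-bipartite : ∀ d → BipartiteSeq (H d)
H-bipartite d k = sideOf ∘ block d ∘ toℕ , λ u v → linked-sides (block d (toℕ u)) (block d (toℕ v))

-- Each member has maximum degree at most d: neighbours fill at most one block.
H-bounded : ∀ d → ΔBounded d (H d)
H-bounded d k v =
  let lo , window = neighbour-window d (block d (toℕ v))
  in count-window (suc k) (λ u → u) (Q ∘ toℕ) Q (λ _ → refl) lo d window
  where
  Q : ℕ → Bool
  Q y = linked (block d (toℕ v)) (block d y)

record MonoCore (d : ℕ) {n : ℕ} (c : Colouring n) : Set where
  field
    place           : Fin (4 * d) → Fin n
    place-injective : Injective _≡_ _≡_ place
    hue             : Bool
    partners-mono   : ∀ (a : Fin 4) (i j : Fin d) → col c (place (vertex a i)) (place (vertex (partner a) j)) ≡ hue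
open MonoCore

H-partners-adjacent : ∀ d k (u v : Fin (suc k)) a (i j : Fin d) →
                      toℕ u ≡ toℕ (vertex a i) → toℕ v ≡ toℕ (vertex (partner a) j) → adj (H d k) u v ≡ true
H-partners-adjacent d k u v a i j u≡ v≡ =
  trans (cong₂ (λ x y → linked (block d x) (block d y)) u≡ v≡)
        (trans (cong₂ linked (block-vertex d a i) (block-vertex d (partner a) j)) (linked-partner a))

-- Without a monochromatic core, every monochromatic copy of a member of H_d
-- has fewer than 4d vertices: a larger one contains the whole core.
copies-small : ∀ d {n} (c : Colouring n) → ¬ MonoCore d c → (m : MonoCopy (H d) c) → suc (k m) < 4 * d
copies-small d c no-core m with 4 * d ≤? suc (k m)
... | no  small = ≰⇒> small
... | yes large = ⊥-elim (no-core core)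
  where
  core : MonoCore d c
  core .place i                = emb m (inject≤ i large)
  core .place-injective eq     = inject≤-injective large large _ _ (inj m eq)
  core .hue                    = colour m
  core .partners-mono a i j    = mono m _ _
    (H-partners-adjacent d (k m) _ _ a i j (toℕ-inject≤ (vertex a i) large) (toℕ-inject≤ (vertex (partner a) j) large))

-- A cover by copies of at most M vertices each covers at most t·M vertices:
-- vertex v ↦ (index of its copy, its position there) is injective.
cover-size : ∀ {F : GraphSeq} {n} {c : Colouring n} {t} M → (∀ (m : MonoCopy F c) → suc (k m) ≤ M) →
             Cover F c t → n ≤ t * M
cover-size {n = n} {t = t} M small cv = injective⇒≤ {f = address} address-injective
  where
  address : Fin n → Fin (t * M)
  address v = let a , x , _ = covers cv v in combine a (fromℕ< (<-≤-trans (toℕ<n x) (small (copy cv a))))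
  address-injective : Injective _≡_ _≡_ address
  address-injective {v} {w} eq with covers cv v | covers cv w
  ... | a , x , ev | b , y , ew with combine-injective a _ b _ eq
  ...   | refl , same-position = begin
    v                  ≡⟨ ev ⟨
    emb (copy cv a) x  ≡⟨ cong (emb (copy cv a)) (toℕ-injective positions) ⟩
    emb (copy cv a) y  ≡⟨ ew ⟩
    w                  ∎
    where
    open ≡-Reasoning
    positions : toℕ x ≡ toℕ y
    positions = trans (sym (toℕ-fromℕ< _)) (trans (cong toℕ same-position) (toℕ-fromℕ< _))

biclique-free⇒core-free : ∀ d {n} (c : Colouring n) → BicliqueFree d c → ¬ MonoCore d c
biclique-free⇒core-free d {n} c free core = free left right (hue core) isBiclique (partners-mono core 0F)
  where
  left right : Fin d → Fin n
  left  i = place core (vertex 0F i)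
  right j = place core (vertex 1F j)
  0≢1 : 0F ≢ 1F
  0≢1 ()
  isBiclique : IsBiclique left right
  isBiclique = (λ {i} {j} eq → proj₂ (vertex-injective 0F i 0F j (place-injective core eq))) ,
               (λ {i} {j} eq → proj₂ (vertex-injective 1F i 1F j (place-injective core eq))) ,
               (λ i j eq → 0≢1 (proj₁ (vertex-injective 0F i 1F j (place-injective core eq))))

isNonzero : ∀ {n} → Fin n → Bool
isNonzero zero    = false
isNonzero (suc _) = true

star : ∀ n → Colouring n
star n = record { col = λ u v → isNonzero u ∧ isNonzero v ; csym = λ u v → ∧-comm (isNonzero u) (isNonzero v) }

star-false : ∀ {n} (u v : Fin (suc n)) → isNonzero u ∧ isNonzero v ≡ false → u ≡ zero ⊎ v ≡ zero
star-false zero    _       _ = inj₁ refl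
star-false (suc _) zero    _ = inj₂ refl
star-false (suc _) (suc _) ()

star-true : ∀ {n} (u v : Fin (suc n)) → isNonzero u ∧ isNonzero v ≡ true → zero ≢ u
star-true (suc _) _ _ ()

-- On exactly 4d ≥ 4 vertices the star colouring has no monochromatic core:
-- a false core would need two disjoint false edges, but they all meet vertex 0;
-- a true core would have to avoid vertex 0 with all of its 4d vertices.
star-core-free : ∀ e → ¬ MonoCore (suc e) (star (4 * suc e))
star-core-free e core with hue core in hue≡
... | false = meet (touches-zero 0F) (touches-zero 2F)
  where
  Hits : Fin 4 → Set
  Hits a = place core (vertex a zero) ≡ zero
  touches-zero : ∀ a → Hits a ⊎ Hits (partner a)
  touches-zero a = star-false _ _ (trans (partners-mono core a zero zero) hue≡)
  apart : ∀ {a b} → a ≢ b → Hits a → Hits b → ⊥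
  apart {a} {b} a≢b pa pb = a≢b (proj₁ (vertex-injective a zero b zero (place-injective core (trans pa (sym pb)))))
  meet : Hits 0F ⊎ Hits 1F → Hits 2F ⊎ Hits 3F → ⊥
  meet (inj₁ p) (inj₁ q) = apart {0F} {2F} (λ ()) p q
  meet (inj₁ p) (inj₂ q) = apart {0F} {3F} (λ ()) p q
  meet (inj₂ p) (inj₁ q) = apart {1F} {2F} (λ ()) p q
  meet (inj₂ p) (inj₂ q) = apart {1F} {3F} (λ ()) p q
... | true = 1+n≰n (injective⇒≤ {f = punchOut ∘ avoids-zero}
                     (λ {x} {y} eq → place-injective core (punchOut-injective (avoids-zero x) (avoids-zero y) eq)))
  where
  avoids-zero : ∀ x → zero ≢ place core x
  avoids-zero x = subst (λ y → zero ≢ place core y) (combine-remQuot {4} (suc e) x)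
                        (star-true _ _ (trans (partners-mono core a i i) hue≡))
    where
    a : Fin 4
    a = proj₁ (remQuot (suc e) x)
    i : Fin (suc e)
    i = proj₂ (remQuot {4} (suc e) x)

-- Some colouring of some K_n forces every cover by monochromatic copies of
-- members of H_D to use t copies with 2^D ≤ t^64, i.e. t ≥ 2^(D/64).
Forcing : ℕ → Set
Forcing D = ∃[ n ] Σ (Colouring n) λ c → ∀ t → Cover (H D) c t → 2 ^ D ≤ t ^ 64

n<2^n : ∀ n → n < 2 ^ n
n<2^n zero    = s≤s z≤n
n<2^n (suc n) = subst (_≤ 2 ^ suc n) (+-comm (suc n) 1)
                  (+-mono-≤ (n<2^n n) (subst (1 ≤_) (sym (+-identityʳ (2 ^ n))) (m^n>0 2 n)))

256b≤2^[7b] : ∀ b → 2 ≤ b → 256 * b ≤ 2 ^ (7 * b)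
256b≤2^[7b] b b≥2 = begin
  256 * b      ≤⟨ *-monoʳ-≤ 256 (<⇒≤ (n<2^n b)) ⟩
  2 ^ 8 * 2 ^ b ≡⟨ ^-distribˡ-+-* 2 8 b ⟨
  2 ^ (8 + b)   ≤⟨ ^-monoʳ-≤ 2 (subst (_≤ 7 * b) (+-comm b 8) (+-monoʳ-≤ b (≤-trans (m≤m+n 8 4) (*-monoʳ-≤ 6 b≥2)))) ⟩
  2 ^ (7 * b)   ∎
  where open ≤-Reasoning

-- The union-bound condition for n = 2^a and K_{D,D}: 2·n^D·n^D < 2^(D²) when 2a + 1 < D.
exponent-gap : ∀ a D → a + a + 1 < D → a * D + a * D + 1 < D * D
exponent-gap a D gap = begin-strict
  a * D + a * D + 1   <⟨ +-monoʳ-< (a * D + a * D) (≤-<-trans (m≤n+m 1 (a + a)) gap) ⟩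
  a * D + a * D + D   ≡⟨ distribute a D ⟩
  (a + a + 1) * D     ≤⟨ *-monoˡ-≤ D (<⇒≤ gap) ⟩
  D * D               ∎
  where
  open ≤-Reasoning
  distribute : ∀ a D → a * D + a * D + D ≡ (a + a + 1) * D
  distribute = solve-∀

-- For n = 2^(8b) and 16b + 1 < D there are fewer than 2^(D²) candidate
-- monochromatic K_{D,D} in K_n, so Erdős's colouring exists.
few-candidates : ∀ b D → 16 * b + 1 < D → ((2 ^ (8 * b)) ^ D * (2 ^ (8 * b)) ^ D) * 2 < 2 ^ (D * D)
few-candidates b D lower = subst (_< 2 ^ (D * D)) powers
  (^-monoʳ-< 2 (s≤s (s≤s z≤n)) (exponent-gap (8 * b) D (subst (λ x → x + 1 < D) (double b) lower)))
  where
  double : ∀ b → 16 * b ≡ 8 * b + 8 * b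
  double = solve-∀
  powers : 2 ^ (8 * b * D + 8 * b * D + 1) ≡ ((2 ^ (8 * b)) ^ D * (2 ^ (8 * b)) ^ D) * 2
  powers = begin
    2 ^ (8 * b * D + 8 * b * D + 1)              ≡⟨ ^-distribˡ-+-* 2 (8 * b * D + 8 * b * D) 1 ⟩
    2 ^ (8 * b * D + 8 * b * D) * 2              ≡⟨ cong (_* 2) (^-distribˡ-+-* 2 (8 * b * D) (8 * b * D)) ⟩
    (2 ^ (8 * b * D) * 2 ^ (8 * b * D)) * 2      ≡⟨ cong (_* 2) (cong₂ _*_ (^-*-assoc 2 (8 * b) D) (^-*-assoc 2 (8 * b) D)) ⟨
    ((2 ^ (8 * b)) ^ D * (2 ^ (8 * b)) ^ D) * 2  ∎
    where open ≡-Reasoning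

large-scale : ∀ D → 64 < D → ∃[ b ] 2 ≤ b × 16 * b + 1 < D × D ≤ 64 * b
large-scale D 64<D = suc q , s≤s q≥1 , lower , upper
  where
  q r : ℕ
  q = D / 64
  r = D % 64
  q≥1 : 1 ≤ q
  q≥1 = m≥n⇒m/n>0 (<⇒≤ 64<D)
  D≡ : D ≡ r + q * 64
  D≡ = m≡m%n+[m/n]*n D 64
  lower : 16 * suc q + 1 < D
  lower = begin-strict
    16 * suc q + 1    <⟨ ≤-reflexive (expand q) ⟩
    18 + 16 * q       ≤⟨ +-monoˡ-≤ (16 * q) (≤-trans (m≤m+n 18 30) (*-monoʳ-≤ 48 q≥1)) ⟩
    48 * q + 16 * q   ≡⟨ collect q ⟩
    q * 64            ≤⟨ m≤n+m (q * 64) r ⟩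
    r + q * 64        ≡⟨ D≡ ⟨
    D                 ∎
    where
    open ≤-Reasoning
    expand : ∀ q → suc (16 * suc q + 1) ≡ 18 + 16 * q
    expand = solve-∀
    collect : ∀ q → 48 * q + 16 * q ≡ q * 64
    collect = solve-∀
  upper : D ≤ 64 * suc q
  upper = begin
    D                 ≡⟨ D≡ ⟩
    r + q * 64        ≤⟨ +-mono-≤ (<⇒≤ (m%n<n D 64)) (≤-reflexive (*-comm q 64)) ⟩
    64 + 64 * q       ≡⟨ *-suc 64 q ⟨
    64 * suc q        ∎
    where open ≤-Reasoning

forcing-zero : Forcing 0
forcing-zero = 1 , star 1 , at-least-one
  where
  at-least-one : ∀ t → Cover (H 0) (star 1) t → 2 ^ 0 ≤ t ^ 64
  at-least-one zero    cv with covers cv zero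
  ... | () , _
  at-least-one (suc t) cv = m^n>0 (suc t) 64

-- 1 ≤ D ≤ 64: under the star colouring of K_{4D} no copy spans all vertices,
-- so at least two copies are needed, and 2^D ≤ 2^64 ≤ t^64.
forcing-small : ∀ e → suc e ≤ 64 → Forcing (suc e)
forcing-small e D≤64 = 4 * suc e , star (4 * suc e) , two-copies
  where
  M : ℕ
  M = pred (4 * suc e)
  two-copies : ∀ t → Cover (H (suc e)) (star (4 * suc e)) t → 2 ^ suc e ≤ t ^ 64
  two-copies t cv = ≤-trans (^-monoʳ-≤ 2 D≤64) (^-monoˡ-≤ 64 (t≥2 t (cover-size M small cv)))
    where
    small : ∀ m → suc (k m) ≤ M
    small m = s≤s⁻¹ (copies-small (suc e) (star (4 * suc e)) (star-core-free e) m)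
    t≥2 : ∀ t → suc M ≤ t * M → 2 ≤ t
    t≥2 zero          ()
    t≥2 (suc zero)    M+1≤M = ⊥-elim (1+n≰n (subst (suc M ≤_) (+-identityʳ M) M+1≤M))
    t≥2 (suc (suc t)) _     = s≤s (s≤s z≤n)

-- 16b + 1 < D ≤ 64b, b ≥ 2: an Erdős colouring of K_n, n = 2^(8b), has no
-- monochromatic K_{D,D}, so every copy has < 4D ≤ 2^(7b) vertices and a cover
-- needs t ≥ n / 2^(7b) = 2^b copies; then 2^D ≤ 2^(64b) ≤ t^64.
forcing-large : ∀ D b → 2 ≤ b → 16 * b + 1 < D → D ≤ 64 * b → Forcing D
forcing-large D b b≥2 lower upper = n , c , many-copies
  where
  n : ℕ
  n = 2 ^ (8 * b)
  erdős : Σ (Colouring n) (BicliqueFree D)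
  erdős = Erdős.biclique-free-colouring n D (few-candidates b D lower)
  c : Colouring n
  c = proj₁ erdős
  many-copies : ∀ t → Cover (H D) c t → 2 ^ D ≤ t ^ 64
  many-copies t cv = begin
    2 ^ D         ≤⟨ ^-monoʳ-≤ 2 upper ⟩
    2 ^ (64 * b)  ≡⟨ cong (2 ^_) (*-comm 64 b) ⟩
    2 ^ (b * 64)  ≡⟨ ^-*-assoc 2 b 64 ⟨
    (2 ^ b) ^ 64  ≤⟨ ^-monoˡ-≤ 64 t≥2^b ⟩
    t ^ 64        ∎
    where
    open ≤-Reasoning
    small : ∀ m → suc (k m) ≤ 4 * D
    small m = <⇒≤ (copies-small D c (biclique-free⇒core-free D c (proj₂ erdős)) m)
    copy-size : 4 * D ≤ 2 ^ (7 * b)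
    copy-size = ≤-trans (*-monoʳ-≤ 4 upper) (subst (_≤ 2 ^ (7 * b)) (*-assoc 4 64 b) (256b≤2^[7b] b b≥2))
    t≥2^b : 2 ^ b ≤ t
    t≥2^b = *-cancelʳ-≤ (2 ^ b) t (2 ^ (7 * b)) {{m^n≢0 2 (7 * b)}} (begin
      2 ^ b * 2 ^ (7 * b)  ≡⟨ ^-distribˡ-+-* 2 b (7 * b) ⟨
      2 ^ (8 * b)          ≤⟨ cover-size (4 * D) small cv ⟩
      t * (4 * D)          ≤⟨ *-monoʳ-≤ t copy-size ⟩
      t * 2 ^ (7 * b)      ∎)

forcing : ∀ D → Forcing D
forcing zero    = forcing-zero
forcing (suc e) with suc e ≤? 64
... | yes D≤64 = forcing-small e D≤64
... | no  D≰64 = let b , b≥2 , lower , upper = large-scale (suc e) (≰⇒> D≰64) in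
                 forcing-large (suc e) b b≥2 lower upper

theorem3 : ∃[ k ] ∀ (Δ : ℕ) → Σ GraphSeq λ F → BipartiteSeq F × ΔBounded Δ F × ∃[ n ] Σ (Colouring n) λ c → ∀ (t : ℕ) → Cover F c t → 2 ^ Δ ≤ t ^ suc k
theorem3 = 63 , λ Δ → H Δ , H-bipartite Δ , H-bounded Δ , forcing Δ
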